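{- Let $f \in \mathbb{N}_0[x^{\pm 1}]$ with $|\operatorname{supp}(f)| \ge 3$. Then there exist $g, h \in \mathbb{N}_0[x^{\pm 1}]$ with $f = g + h$, $g$ hyper-monolithic, and $h(1) \le g(1)$.
   Context: $\mathbb{N}_0[x^{\pm 1}]$ denotes the commutative semiring of Laurent polynomials in $x$ with nonnegative integer coefficients. The support $\operatorname{supp}(f)$ is the set of exponents appearing in $f$ with nonzero coefficient, and $f(1)$ is the sum of the coefficients of $f$. Write a polynomial $g = \sum_{i=0}^m e_i x^{t_i}$ with positive integers $e_i$ and integers $t_0 > \cdots > t_m$; $g$ is hyper-monolithic if $m \ge 1$ and either $t_0 - t_1 < t_i - t_{i+1}$ for every $i \in \{1, \ldots, m-1\}$, or $t_{m-1} - t_m < t_j - t_{j+1}$ for every $j \in \{0, \ldots, m-2\}$. -}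

module Defs where

open import Data.Nat using (ℕ; zero; suc; _+_; _∸_; _≤_; _<_)
open import Data.Integer as ℤ using (ℤ; +_; -[1+_]; ∣_∣)
open import Data.Product using (Σ; _×_; ∃; ∃-syntax)
open import Data.Sum using (_⊎_)
open import Relation.Binary.PropositionalEquality using (_≡_; _≢_)

-- An element of ℕ₀[x^{±1}]: a coefficient function ℤ → ℕ with finite support,
-- witnessed by a bound outside of which all coefficients vanish.
record Laurent : Set where
  field
    coeff  : ℤ → ℕ
    bound  : ℕ
    vanish : ∀ k → bound < ∣ k ∣ → coeff k ≡ 0
open Laurent public

sumSym : ℕ → (ℤ → ℕ) → ℕ
sumSym zero    c = c (+ 0)
sumSym (suc n) c = sumSym n c + c (+ suc n) + c -[1+ n ]

eval1 : Laurent → ℕ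
eval1 f = sumSym (bound f) (coeff f)

InSupp : Laurent → ℤ → Set
InSupp f k = coeff f k ≢ 0

SuppAtLeast3 : Laurent → Set
SuppAtLeast3 f = ∃[ a ] ∃[ b ] ∃[ c ]
  (a ≢ b × a ≢ c × b ≢ c × InSupp f a × InSupp f b × InSupp f c)

IsSum : Laurent → Laurent → Laurent → Set
IsSum f g h = ∀ k → coeff f k ≡ coeff g k + coeff h k

-- g = Σ_{i=0}^m e_i x^{t_i}, t_0 > ... > t_m, e_i > 0:
-- t (restricted to 0..m) is the strictly decreasing enumeration of supp(g).
-- Gap d_i = t_i - t_{i+1}.
HyperMonolithic : Laurent → Set
HyperMonolithic g = Σ ℕ λ m → Σ (ℕ → ℤ) λ t →
    1 ≤ m
  × (∀ i j → i < j → j ≤ m → t j ℤ.< t i)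
  × (∀ i → i ≤ m → InSupp g (t i))
  × (∀ k → InSupp g k → ∃[ i ] (i ≤ m × t i ≡ k))
  × ( (∀ i → 1 ≤ i → i + 1 ≤ m →
          t 0 ℤ.- t 1 ℤ.< t i ℤ.- t (suc i))
    ⊎ (∀ j → j + 2 ≤ m →
          t (m ∸ 1) ℤ.- t m ℤ.< t j ℤ.- t (suc j)))

-- List supp f decreasingly as P and let δ be its smallest gap, attained first at u > v, so that
-- all gaps above u exceed δ. Scanning P from the bottom up to v, one maintains a cover by a list X
-- with all gaps > δ and a list Y whose gaps exceed δ except the last one, which is δ, and in the
-- end v can be made to head X. Then u ∷ X has a strictly smallest first gap and (P above u) ++ Y
-- a strictly smallest last gap, so f restricted to either list is hyper-monolithic. The two
-- restrictions together dominate f, so the heavier one g satisfies (f − g)(1) ≤ f(1)/2 ≤ g(1).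
module Submission where

module Gaps where

  open import Data.Integer using (ℤ; 0ℤ; _+_; _-_; -_; _<_; _≤_; _<?_; _≟_)
  open import Data.Integer.Properties
    using ( ≤-refl; ≤-reflexive; ≤-trans; <-trans; <⇒≤; ≤-<-trans; <-≤-trans; ≤∧≢⇒<; ≮⇒≥
          ; +-identityʳ; +-inverseʳ; +-monoʳ-≤; +-monoˡ-≤; +-monoʳ-<; +-monoˡ-< )
  open import Data.Integer.Tactic.RingSolver using (solve-∀)
  open import Data.List using (List; []; _∷_; _++_)
  open import Data.List.Membership.Propositional using (_∈_)
  open import Data.List.Membership.Propositional.Properties using (∈-++⁺ˡ; ∈-++⁺ʳ)
  open import Data.List.Relation.Binary.Subset.Propositional using (_⊆_)
  open import Data.List.Relation.Binary.Subset.Propositional.Properties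
    using (⊆-refl; ⊆-trans; xs⊆x∷xs; ∷⁺ʳ; ∈-∷⁺ʳ; xs⊆xs++ys; ++⁺ʳ)
  open import Data.List.Relation.Unary.Any using (here; there)
  open import Data.List.Relation.Unary.Linked as Linked using (Linked; [-]; _∷_)
  open import Data.Product using (Σ-syntax; _×_; _,_)
  open import Relation.Binary.PropositionalEquality using (_≡_; refl; subst)
  open import Relation.Nullary using (yes; no)

  Decreasing : List ℤ → Set
  Decreasing = Linked (λ x y → y < x)

  GapsAbove GapsAtLeast : ℤ → List ℤ → Set
  GapsAbove δ = Linked (λ x y → y + δ < x)
  GapsAtLeast δ = Linked (λ x y → y + δ ≤ x)

  data TightFirst (δ : ℤ) : List ℤ → Set where
    tight-first : ∀ {x y r} → y + δ ≡ x → GapsAbove δ (y ∷ r) → TightFirst δ (x ∷ y ∷ r)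

  data TightLast (δ : ℤ) : List ℤ → Set where
    tight-last : ∀ {x y} → y + δ ≡ x → TightLast δ (x ∷ y ∷ [])
    _∷_ : ∀ {x y r} → y + δ < x → TightLast δ (y ∷ r) → TightLast δ (x ∷ y ∷ r)

  record Cover (P Q : List ℤ → Set) (S : List ℤ) : Set where
    constructor cover
    field
      X Y : List ℤ
      P-X : P X
      Q-Y : Q Y
      X⊆S : X ⊆ S
      Y⊆S : Y ⊆ S
      S⊆X++Y : S ⊆ X ++ Y

  TightCover : ℤ → List ℤ → Set
  TightCover δ = Cover (TightFirst δ) (TightLast δ)

  insert-⊆ : ∀ {S X Y : List ℤ} s → S ⊆ X ++ Y → s ∷ S ⊆ X ++ s ∷ Y
  insert-⊆ {X = X} {Y} s S⊆ = ∈-∷⁺ʳ (∈-++⁺ʳ X (here refl)) (⊆-trans S⊆ (++⁺ʳ X (xs⊆x∷xs Y s)))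

  <+δ : ∀ {δ} → 0ℤ < δ → ∀ s → s < s + δ
  <+δ {δ} δ>0 s = subst (_< s + δ) (+-identityʳ s) (+-monoʳ-< s δ>0)

  module Covering {δ : ℤ} (δ>0 : 0ℤ < δ) where

    tight⇒< : ∀ {s s′} → s + δ ≡ s′ → s < s′
    tight⇒< {s} tight = subst (s <_) tight (<+δ δ>0 s)

    loose⇒< : ∀ {s s′} → s + δ < s′ → s < s′
    loose⇒< = <-trans (<+δ δ>0 _)

    GapsAbove⇒Decreasing : ∀ {L} → GapsAbove δ L → Decreasing L
    GapsAbove⇒Decreasing = Linked.map loose⇒<

    TightFirst⇒Decreasing : ∀ {L} → TightFirst δ L → Decreasing L
    TightFirst⇒Decreasing (tight-first e g) = tight⇒< e ∷ GapsAbove⇒Decreasing g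

    TightLast⇒Decreasing : ∀ {L} → TightLast δ L → Decreasing L
    TightLast⇒Decreasing (tight-last e) = tight⇒< e ∷ [-]
    TightLast⇒Decreasing (y+δ<x ∷ t) = loose⇒< y+δ<x ∷ TightLast⇒Decreasing t

    below-head : ∀ {s S z} → GapsAtLeast δ (s ∷ S) → z ∈ S → z + δ ≤ s
    below-head (z+δ≤s ∷ _) (here refl) = z+δ≤s
    below-head (t+δ≤s ∷ g) (there z∈S) = ≤-trans (below-head g z∈S) (≤-trans (<⇒≤ (<+δ δ>0 _)) t+δ≤s)

    ≤-head : ∀ {s S z} → GapsAtLeast δ (s ∷ S) → z ∈ s ∷ S → z ≤ s
    ≤-head g (here refl) = ≤-refl
    ≤-head g (there z∈S) = ≤-trans (<⇒≤ (<+δ δ>0 _)) (below-head g z∈S)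

    cons-gapsAbove : ∀ {s X} → (∀ {z} → z ∈ X → z + δ < s) → GapsAbove δ X → GapsAbove δ (s ∷ X)
    cons-gapsAbove {X = []} _ _ = [-]
    cons-gapsAbove {X = _ ∷ _} below g = below (here refl) ∷ g

    cons-tightLast : ∀ {s Y} → (∀ {z} → z ∈ Y → z + δ < s) → TightLast δ Y → TightLast δ (s ∷ Y)
    cons-tightLast below t@(tight-last _) = below (here refl) ∷ t
    cons-tightLast below t@(_ ∷ _) = below (here refl) ∷ t

    raise-head : ∀ {t v S} → t ≤ v → GapsAbove δ (t ∷ S) → GapsAbove δ (v ∷ S)
    raise-head _ [-] = [-]
    raise-head t≤v (h ∷ g) = <-≤-trans h t≤v ∷ g

    -- Covers of s ∷ S in which s heads the δ-separated part X, resp. the part Y with the tight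
    -- last gap; the head s itself is not stored, so X, Y ⊆ S.
    XHeaded YHeaded : ℤ → List ℤ → Set
    XHeaded s = Cover (λ X → GapsAbove δ (s ∷ X)) (TightLast δ)
    YHeaded s = Cover (GapsAbove δ) (λ Y → TightLast δ (s ∷ Y))

    module _ {s s′ : ℤ} {S : List ℤ} (g : GapsAtLeast δ (s ∷ S)) (s<s′ : s < s′) where

      below-new-head : ∀ {z} → z ∈ S → z + δ < s′
      below-new-head z∈S = ≤-<-trans (below-head g z∈S) s<s′

      YHeaded⇒XHeaded : YHeaded s S → XHeaded s′ (s ∷ S)
      YHeaded⇒XHeaded (cover X Y gX tY X⊆S Y⊆S S⊆) =
        cover X (s ∷ Y) (cons-gapsAbove (λ z∈X → below-new-head (X⊆S z∈X)) gX) tY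
          (⊆-trans X⊆S (xs⊆x∷xs S s)) (∷⁺ʳ s Y⊆S) (insert-⊆ s S⊆)

      XHeaded⇒YHeaded : XHeaded s S → YHeaded s′ (s ∷ S)
      XHeaded⇒YHeaded (cover X Y gX tY X⊆S Y⊆S S⊆) =
        cover (s ∷ X) Y gX (cons-tightLast (λ z∈Y → below-new-head (Y⊆S z∈Y)) tY)
          (∷⁺ʳ s X⊆S) (⊆-trans Y⊆S (xs⊆x∷xs S s)) (∷⁺ʳ s S⊆)

    module _ {s s′ : ℤ} {S : List ℤ} (s+δ<s′ : s + δ < s′) where

      XHeaded⇒XHeaded : XHeaded s S → XHeaded s′ (s ∷ S)
      XHeaded⇒XHeaded (cover X Y gX tY X⊆S Y⊆S S⊆) =
        cover (s ∷ X) Y (s+δ<s′ ∷ gX) tY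
          (∷⁺ʳ s X⊆S) (⊆-trans Y⊆S (xs⊆x∷xs S s)) (∷⁺ʳ s S⊆)

      YHeaded⇒YHeaded : YHeaded s S → YHeaded s′ (s ∷ S)
      YHeaded⇒YHeaded (cover X Y gX tY X⊆S Y⊆S S⊆) =
        cover X (s ∷ Y) gX (s+δ<s′ ∷ tY)
          (⊆-trans X⊆S (xs⊆x∷xs S s)) (∷⁺ʳ s Y⊆S) (insert-⊆ s S⊆)

    tight-pair : ∀ {s s′ S} → s + δ ≡ s′ → GapsAbove δ S → YHeaded s′ (s ∷ S)
    tight-pair {s} {S = S} e gS =
      cover S (s ∷ []) gS (tight-last e) (xs⊆x∷xs S s) (∷⁺ʳ s (λ ())) (insert-⊆ s (xs⊆xs++ys S []))

    data Situation : List ℤ → Set where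
      sparse : ∀ {S} → GapsAbove δ S → Situation S
      tight-over-sparse : ∀ {s t S} → t + δ ≡ s → GapsAbove δ (t ∷ S) → Situation (s ∷ t ∷ S)
      covered : ∀ {s S} → XHeaded s S → YHeaded s S → Situation (s ∷ S)

    -- A new head at distance exactly δ swaps the roles of X and Y; at a larger distance an
    -- X-headed cover yields both kinds.
    module _ {s s′ : ℤ} {S : List ℤ} (g : GapsAtLeast δ (s ∷ S)) where

      extend-tight : s + δ ≡ s′ → Situation (s ∷ S) → Situation (s′ ∷ s ∷ S)
      extend-tight tight (sparse gS) = tight-over-sparse tight gS
      extend-tight tight (tight-over-sparse e gT) =
        covered (YHeaded⇒XHeaded g (tight⇒< tight) (tight-pair e (Linked.tail gT))) (tight-pair tight gT)
      extend-tight tight (covered x y) =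
        covered (YHeaded⇒XHeaded g (tight⇒< tight) y) (XHeaded⇒YHeaded g (tight⇒< tight) x)

      extend-loose : s + δ < s′ → Situation (s ∷ S) → Situation (s′ ∷ s ∷ S)
      extend-loose loose (sparse gS) = sparse (loose ∷ gS)
      extend-loose loose (tight-over-sparse e gT) =
        covered (YHeaded⇒XHeaded g (loose⇒< loose) pair) (YHeaded⇒YHeaded loose pair)
        where
        pair : YHeaded s _
        pair = tight-pair e (Linked.tail gT)
      extend-loose loose (covered x _) =
        covered (XHeaded⇒XHeaded loose x) (XHeaded⇒YHeaded g (loose⇒< loose) x)

    situation : ∀ s S → GapsAtLeast δ (s ∷ S) → Situation (s ∷ S)
    situation s [] _ = sparse [-]
    situation s (t ∷ S) (t+δ≤s ∷ g) with t + δ ≟ s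
    ... | yes tight = extend-tight g tight (situation t S g)
    ... | no loose = extend-loose g (≤∧≢⇒< t+δ≤s loose) (situation t S g)

    tightCover-start : ∀ {u v T} → v + δ ≡ u → Situation (v ∷ T) → TightCover δ (u ∷ v ∷ T)
    tightCover-start {u} {v} {T} e (sparse gT) =
      cover (u ∷ v ∷ T) (u ∷ v ∷ []) (tight-first e gT) (tight-last e) ⊆-refl
        (∷⁺ʳ u (∷⁺ʳ v (λ ()))) (xs⊆xs++ys _ _)
    tightCover-start {u} {v} e (tight-over-sparse {t = t} {S} e′ gT) =
      cover (u ∷ v ∷ S) (v ∷ t ∷ []) (tight-first e (raise-head t≤v gT)) (tight-last e′)
        (∷⁺ʳ u (∷⁺ʳ v (xs⊆x∷xs S t))) (λ z∈ → there (∷⁺ʳ v (∷⁺ʳ t (λ ())) z∈)) covers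
      where
      t≤v : t ≤ v
      t≤v = <⇒≤ (tight⇒< e′)
      covers : u ∷ v ∷ t ∷ S ⊆ (u ∷ v ∷ S) ++ v ∷ t ∷ []
      covers (here refl) = here refl
      covers (there (here refl)) = there (here refl)
      covers (there (there (here refl))) = ∈-++⁺ʳ (u ∷ v ∷ S) (there (here refl))
      covers (there (there (there z∈S))) = there (there (∈-++⁺ˡ z∈S))
    tightCover-start {u} {v} e (covered (cover X Y gX tY X⊆T Y⊆T T⊆) _) =
      cover (u ∷ v ∷ X) Y (tight-first e gX) tY (∷⁺ʳ u (∷⁺ʳ v X⊆T))
        (λ z∈Y → there (there (Y⊆T z∈Y))) (∷⁺ʳ u (∷⁺ʳ v T⊆))

    tightCover-cons : ∀ {a p P} → p + δ < a → GapsAtLeast δ (p ∷ P) → TightCover δ (p ∷ P) →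
      TightCover δ (a ∷ p ∷ P)
    tightCover-cons {a} p+δ<a g (cover A Y tA tY A⊆ Y⊆ P⊆) =
      cover A (a ∷ Y) tA (cons-tightLast below-a tY) (⊆-trans A⊆ (xs⊆x∷xs _ a)) (∷⁺ʳ a Y⊆) (insert-⊆ a P⊆)
      where
      below-a : ∀ {z} → z ∈ Y → z + δ < a
      below-a z∈Y = ≤-<-trans (+-monoˡ-≤ δ (≤-head g (Y⊆ z∈Y))) p+δ<a

  open Covering using (situation; tightCover-start; tightCover-cons)

  y+[x-y]≡x : ∀ x y → y + (x - y) ≡ x
  y+[x-y]≡x = solve-∀

  [y+δ]-y≡δ : ∀ y δ → y + δ - y ≡ δ
  [y+δ]-y≡δ = solve-∀

  y<x⇒0<x-y : ∀ {x y} → y < x → 0ℤ < x - y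
  y<x⇒0<x-y {x} {y} y<x = subst (_< x - y) (+-inverseʳ y) (+-monoˡ-< (- y) y<x)

  x≤y+δ⇒x-y≤δ : ∀ {x y δ} → x ≤ y + δ → x - y ≤ δ
  x≤y+δ⇒x-y≤δ {y = y} {δ} x≤y+δ = subst (_ ≤_) ([y+δ]-y≡δ y δ) (+-monoˡ-≤ (- y) x≤y+δ)

  GapsAtLeast-weaken : ∀ {δ δ′ L} → δ′ ≤ δ → GapsAtLeast δ L → GapsAtLeast δ′ L
  GapsAtLeast-weaken δ′≤δ = Linked.map (λ {_} {b} b+δ≤a → ≤-trans (+-monoʳ-≤ b δ′≤δ) b+δ≤a)

  MinGapCover : List ℤ → Set
  MinGapCover L = Σ[ δ ∈ ℤ ] (0ℤ < δ × GapsAtLeast δ L × TightCover δ L)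

  minGapCover-atTop : ∀ {x y r} → y < x → GapsAtLeast (x - y) (y ∷ r) → MinGapCover (x ∷ y ∷ r)
  minGapCover-atTop {x} {y} {r} y<x g =
    x - y , δ>0 , ≤-reflexive tight ∷ g , tightCover-start δ>0 tight (situation δ>0 y r g)
    where
    δ>0 : 0ℤ < x - y
    δ>0 = y<x⇒0<x-y y<x
    tight : y + (x - y) ≡ x
    tight = y+[x-y]≡x x y

  minGapCover : ∀ x y r → Decreasing (x ∷ y ∷ r) → MinGapCover (x ∷ y ∷ r)
  minGapCover x y [] (y<x ∷ [-]) = minGapCover-atTop y<x [-]
  minGapCover x y (z ∷ r) (y<x ∷ d) with minGapCover y z r d
  ... | δ , δ>0 , g , c with y + δ <? x
  ...   | yes y+δ<x = δ , δ>0 , <⇒≤ y+δ<x ∷ g , tightCover-cons δ>0 y+δ<x g c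
  ...   | no y+δ≮x = minGapCover-atTop y<x (GapsAtLeast-weaken (x≤y+δ⇒x-y≤δ (≮⇒≥ y+δ≮x)) g)

module Support where

  open import Data.Integer as ℤ using (ℤ; +_; -[1+_]; 0ℤ; _+_; _-_; _<_; _≟_; pred; ∣_∣; +≤+; -≤+)
  open import Data.Integer.Properties
    using ( ≤-refl; ≤-antisym; <-trans; ≤∧≢⇒<; +-monoˡ-<; +-identityʳ; pos-+; ⊖-≥
          ; i≤pred[j]⇒i<j; i<j⇒i≤pred[j]; pred-mono )
  open import Data.Integer.Tactic.RingSolver using (solve-∀)
  open import Data.List using (List; []; _∷_; length; filter)
  open import Data.List.Membership.Propositional using (_∈_)
  open import Data.List.Membership.Propositional.Properties using (∈-filter⁺; ∈-filter⁻)
  open import Data.List.Membership.DecPropositional ℤ._≟_ using (_∈?_)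
  open import Data.List.Relation.Unary.All using (lookup)
  open import Data.List.Relation.Unary.Any using (here; there)
  open import Data.List.Relation.Unary.Linked as Linked using ([-]; _∷_)
  open import Data.List.Relation.Unary.Linked.Properties using (Linked⇒All; filter⁺)
  open import Data.Nat as ℕ using (ℕ; zero; suc; z≤n; s≤s)
  import Data.Nat.Properties as ℕₚ
  open import Data.Product using (∃-syntax; _×_; _,_; proj₂)
  open import Data.Sum using (_⊎_; inj₁; inj₂)
  open import Relation.Binary.PropositionalEquality using (_≡_; _≢_; refl; sym; trans; cong; subst)
  open import Relation.Nullary using (Dec; yes; no; ¬?; contradiction)
  open import Defs
  open Gaps

  -- Lists are read as the sequences t of HyperMonolithic, with junk value 0 past the end.
  _!_ : List ℤ → ℕ → ℤ
  [] ! _ = 0ℤ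
  (x ∷ _) ! zero = x
  (_ ∷ xs) ! suc i = xs ! i

  !-∈ : ∀ L {i} → i ℕ.< length L → L ! i ∈ L
  !-∈ (x ∷ L) {zero} _ = here refl
  !-∈ (x ∷ L) {suc i} (s≤s i<n) = there (!-∈ L i<n)

  ∈⇒! : ∀ {k} L → k ∈ L → ∃[ i ] (i ℕ.< length L × L ! i ≡ k)
  ∈⇒! (x ∷ L) (here refl) = zero , s≤s z≤n , refl
  ∈⇒! (x ∷ L) (there k∈L) with ∈⇒! L k∈L
  ... | i , i<n , refl = suc i , s≤s i<n , refl

  Decreasing⇒! : ∀ L → Decreasing L → ∀ {i j} → i ℕ.< j → j ℕ.< length L → L ! j < L ! i
  Decreasing⇒! (x ∷ L) (y<x ∷ d) {zero} {suc j} _ (s≤s j<n) =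
    lookup (Linked⇒All (λ b<a c<b → <-trans c<b b<a) y<x d) (!-∈ L j<n)
  Decreasing⇒! (x ∷ L) d {suc i} {suc j} (s≤s i<j) (s≤s j<n) = Decreasing⇒! L (Linked.tail d) i<j j<n

  gap : List ℤ → ℕ → ℤ
  gap L i = L ! i - L ! suc i

  FirstGapLeast LastGapLeast : List ℤ → Set
  FirstGapLeast L = ∀ i → 1 ℕ.≤ i → i ℕ.+ 1 ℕ.≤ length L ℕ.∸ 1 → gap L 0 < gap L i
  LastGapLeast L = ∀ j → j ℕ.+ 2 ℕ.≤ length L ℕ.∸ 1 → gap L (length L ℕ.∸ 1 ℕ.∸ 1) < gap L j

  tight⇒gap : ∀ {δ x y} → y + δ ≡ x → x - y ≡ δ
  tight⇒gap {δ} {y = y} refl = [y+δ]-y≡δ y δ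

  loose⇒gap : ∀ {δ x y} → y + δ < x → δ < x - y
  loose⇒gap {δ} {y = y} y+δ<x = subst (_< _) ([y+δ]-y≡δ y δ) (+-monoˡ-< (ℤ.- y) y+δ<x)

  GapsAbove⇒gap : ∀ {δ} L → GapsAbove δ L → ∀ i → suc i ℕ.< length L → δ < gap L i
  GapsAbove⇒gap (x ∷ []) [-] zero (s≤s ())
  GapsAbove⇒gap (x ∷ y ∷ L) (y+δ<x ∷ _) zero _ = loose⇒gap y+δ<x
  GapsAbove⇒gap (x ∷ y ∷ L) (_ ∷ g) (suc i) (s≤s i<n) = GapsAbove⇒gap (y ∷ L) g i i<n

  TightFirst⇒FirstGapLeast : ∀ {δ L} → TightFirst δ L → FirstGapLeast L
  TightFirst⇒FirstGapLeast {L = x ∷ y ∷ r} (tight-first e g) (suc i) _ i+2≤n =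
    subst (_< _) (sym (tight⇒gap e))
      (GapsAbove⇒gap (y ∷ r) g i (subst (ℕ._≤ suc (length r)) (ℕₚ.+-comm (suc i) 1) i+2≤n))

  TightLast⇒lastGap : ∀ {δ L} → TightLast δ L → gap L (length L ℕ.∸ 1 ℕ.∸ 1) ≡ δ
  TightLast⇒lastGap (tight-last e) = tight⇒gap e
  TightLast⇒lastGap (_ ∷ t@(tight-last _)) = TightLast⇒lastGap t
  TightLast⇒lastGap (_ ∷ t@(_ ∷ _)) = TightLast⇒lastGap t

  TightLast⇒innerGap : ∀ {δ L} → TightLast δ L → ∀ j → j ℕ.+ 2 ℕ.≤ length L ℕ.∸ 1 → δ < gap L j
  TightLast⇒innerGap (tight-last _) j j+2≤1 = contradiction (ℕₚ.m+n≤o⇒n≤o j j+2≤1) λ { (s≤s ()) }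
  TightLast⇒innerGap (y+δ<x ∷ _) zero _ = loose⇒gap y+δ<x
  TightLast⇒innerGap (_ ∷ t@(tight-last _)) (suc j) (s≤s j+2≤n) = TightLast⇒innerGap t j j+2≤n
  TightLast⇒innerGap (_ ∷ t@(_ ∷ _)) (suc j) (s≤s j+2≤n) = TightLast⇒innerGap t j j+2≤n

  TightLast⇒LastGapLeast : ∀ {δ L} → TightLast δ L → LastGapLeast L
  TightLast⇒LastGapLeast t j j+2≤n =
    subst (_< _) (sym (TightLast⇒lastGap t)) (TightLast⇒innerGap t j j+2≤n)

  restrict-coeff : Laurent → List ℤ → ℤ → ℕ
  restrict-coeff f L k with k ∈? L
  ... | yes _ = coeff f k
  ... | no _ = 0

  restrict-≤ : ∀ f L k → restrict-coeff f L k ℕ.≤ coeff f k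
  restrict-≤ f L k with k ∈? L
  ... | yes _ = ℕₚ.≤-refl
  ... | no _ = z≤n

  restrict-∈ : ∀ f L {k} → k ∈ L → restrict-coeff f L k ≡ coeff f k
  restrict-∈ f L {k} k∈L with k ∈? L
  ... | yes _ = refl
  ... | no k∉L = contradiction k∈L k∉L

  restrict-supp : ∀ f L {k} → restrict-coeff f L k ≢ 0 → k ∈ L
  restrict-supp f L {k} nz with k ∈? L
  ... | yes k∈L = k∈L
  ... | no _ = contradiction refl nz

  restrict : Laurent → List ℤ → Laurent
  restrict f L = record
    { coeff = restrict-coeff f L
    ; bound = bound f
    ; vanish = λ k B<∣k∣ →
        ℕₚ.n≤0⇒n≡0 (subst (restrict-coeff f L k ℕ.≤_) (vanish f k B<∣k∣) (restrict-≤ f L k))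
    }

  restrict-hyperMonolithic : ∀ f x y r → Decreasing (x ∷ y ∷ r) →
    (∀ {k} → k ∈ x ∷ y ∷ r → InSupp f k) → FirstGapLeast (x ∷ y ∷ r) ⊎ LastGapLeast (x ∷ y ∷ r) → HyperMonolithic (restrict f (x ∷ y ∷ r))
  restrict-hyperMonolithic f x y r d L⊆supp gaps =
    suc (length r) , L !_ , s≤s z≤n , ordered , inSupp , complete , gaps
    where
    L = x ∷ y ∷ r
    ordered : ∀ i j → i ℕ.< j → j ℕ.≤ suc (length r) → L ! j < L ! i
    ordered i j i<j j≤m = Decreasing⇒! L d i<j (s≤s j≤m)
    inSupp : ∀ i → i ℕ.≤ suc (length r) → InSupp (restrict f L) (L ! i)
    inSupp i i≤m = subst (_≢ 0) (sym (restrict-∈ f L Li∈L)) (L⊆supp Li∈L)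
      where
      Li∈L : L ! i ∈ L
      Li∈L = !-∈ L (s≤s i≤m)
    complete : ∀ k → InSupp (restrict f L) k → ∃[ i ] (i ℕ.≤ suc (length r) × L ! i ≡ k)
    complete k nz with ∈⇒! L (restrict-supp f L nz)
    ... | i , s≤s i≤m , Li≡k = i , i≤m , Li≡k

  module _ {f : Laurent} {δ : ℤ} (δ>0 : 0ℤ < δ) where

    open Covering δ>0 using (TightFirst⇒Decreasing; TightLast⇒Decreasing)

    TightFirst⇒hyperMonolithic : ∀ {L} → TightFirst δ L → (∀ {k} → k ∈ L → InSupp f k) →
      HyperMonolithic (restrict f L)
    TightFirst⇒hyperMonolithic t@(tight-first _ _) L⊆supp =
      restrict-hyperMonolithic f _ _ _ (TightFirst⇒Decreasing t) L⊆supp (inj₁ (TightFirst⇒FirstGapLeast t))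

    TightLast⇒hyperMonolithic : ∀ {L} → TightLast δ L → (∀ {k} → k ∈ L → InSupp f k) →
      HyperMonolithic (restrict f L)
    TightLast⇒hyperMonolithic t@(tight-last _) L⊆supp =
      restrict-hyperMonolithic f _ _ _ (TightLast⇒Decreasing t) L⊆supp (inj₂ (TightLast⇒LastGapLeast t))
    TightLast⇒hyperMonolithic t@(_ ∷ _) L⊆supp =
      restrict-hyperMonolithic f _ _ _ (TightLast⇒Decreasing t) L⊆supp (inj₂ (TightLast⇒LastGapLeast t))

  countdown : ℕ → ℤ → List ℤ
  countdown zero z = z ∷ []
  countdown (suc n) z = z ∷ countdown n (pred z)

  pred<z : ∀ z → pred z < z
  pred<z z = i≤pred[j]⇒i<j ≤-refl

  countdown-decreasing : ∀ n z → Decreasing (countdown n z)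
  countdown-decreasing zero z = [-]
  countdown-decreasing (suc zero) z = pred<z z ∷ [-]
  countdown-decreasing (suc (suc n)) z = pred<z z ∷ countdown-decreasing (suc n) (pred z)

  pred[k+1+n]≡k+n : ∀ k n → pred (k + + suc n) ≡ k + + n
  pred[k+1+n]≡k+n k n = trans (cong (λ m → pred (k + m)) (pos-+ 1 n)) (-1+[k+[1+m]]≡k+m k (+ n))
    where
    -1+[k+[1+m]]≡k+m : ∀ k m → ℤ.- ℤ.1ℤ + (k + (ℤ.1ℤ + m)) ≡ k + m
    -1+[k+[1+m]]≡k+m = solve-∀

  ∈-countdown : ∀ n z {k} → k ℤ.≤ z → z ℤ.≤ k + + n → k ∈ countdown n z
  ∈-countdown zero z {k} k≤z z≤k+0 = here (≤-antisym k≤z (subst (z ℤ.≤_) (+-identityʳ k) z≤k+0))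
  ∈-countdown (suc n) z {k} k≤z z≤k+1+n with k ≟ z
  ... | yes k≡z = here k≡z
  ... | no k≢z = there (∈-countdown n (pred z) (i<j⇒i≤pred[j] (≤∧≢⇒< k≤z k≢z))
                   (subst (pred z ℤ.≤_) (pred[k+1+n]≡k+n k n) (pred-mono z≤k+1+n)))

  ∣k∣≤B⇒∈countdown : ∀ B k → ∣ k ∣ ℕ.≤ B → k ∈ countdown (B ℕ.+ B) (+ B)
  ∣k∣≤B⇒∈countdown B (+ m) m≤B =
    ∈-countdown _ _ (+≤+ m≤B) (+≤+ (ℕₚ.≤-trans (ℕₚ.m≤m+n B B) (ℕₚ.m≤n+m (B ℕ.+ B) m)))
  ∣k∣≤B⇒∈countdown B -[1+ m ] 1+m≤B = ∈-countdown _ _ -≤+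
    (subst (+ B ℤ.≤_) (sym (⊖-≥ (ℕₚ.≤-trans 1+m≤B (ℕₚ.m≤m+n B B))))
      (+≤+ (subst (ℕ._≤ (B ℕ.+ B) ℕ.∸ suc m) (ℕₚ.m+n∸n≡m B B) (ℕₚ.∸-monoʳ-≤ (B ℕ.+ B) 1+m≤B))))

  InSupp? : ∀ f k → Dec (InSupp f k)
  InSupp? f k = ¬? (coeff f k ℕ.≟ 0)

  support : Laurent → List ℤ
  support f = filter (InSupp? f) (countdown (bound f ℕ.+ bound f) (+ bound f))

  support-decreasing : ∀ f → Decreasing (support f)
  support-decreasing f =
    filter⁺ (InSupp? f) (λ b<a c<b → <-trans c<b b<a) (countdown-decreasing (bound f ℕ.+ bound f) (+ bound f))

  ∈-support⁻ : ∀ f {k} → k ∈ support f → InSupp f k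
  ∈-support⁻ f k∈ =
    proj₂ (∈-filter⁻ (InSupp? f) {xs = countdown (bound f ℕ.+ bound f) (+ bound f)} k∈)

  ∈-support⁺ : ∀ f {k} → InSupp f k → k ∈ support f
  ∈-support⁺ f {k} nz = ∈-filter⁺ (InSupp? f) (∣k∣≤B⇒∈countdown (bound f) k ∣k∣≤B) nz
    where
    ∣k∣≤B : ∣ k ∣ ℕ.≤ bound f
    ∣k∣≤B = ℕₚ.≮⇒≥ (λ B<∣k∣ → nz (vanish f k B<∣k∣))

open import Data.Integer using (ℤ; +_; -[1+_])
open import Data.List using ([]; _∷_; _++_)
open import Data.List.Membership.Propositional using (_∈_)
open import Data.List.Membership.Propositional.Properties using (∈-++⁻)
open import Data.List.Relation.Unary.Any.Properties using (singleton⁻)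
open import Data.Nat using (ℕ; zero; suc; _+_; _∸_; _≤_; _≟_; z≤n)
open import Data.Nat.Properties
  using (≤-trans; ≤-total; +-mono-≤; +-comm; +-cancelˡ-≤; m+[n∸m]≡n; m≤m+n; m≤n+m; 0∸n≡0)
open import Data.Nat.Tactic.RingSolver using (solve-∀)
open import Data.Product using (_×_; ∃-syntax; _,_)
open import Data.Sum using (inj₁; inj₂)
open import Function using (_∘_)
open import Relation.Binary.PropositionalEquality
  using (_≡_; refl; sym; trans; cong; cong₂; subst; module ≡-Reasoning)
open import Relation.Nullary using (yes; no; contradiction)
open import Defs
open Gaps using (Decreasing; cover; minGapCover)
open Support

sumSym-cong : ∀ n {c d : ℤ → ℕ} → (∀ k → c k ≡ d k) → sumSym n c ≡ sumSym n d
sumSym-cong zero c≡d = c≡d _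
sumSym-cong (suc n) c≡d = cong₂ _+_ (cong₂ _+_ (sumSym-cong n c≡d) (c≡d _)) (c≡d _)

sumSym-mono : ∀ n {c d : ℤ → ℕ} → (∀ k → c k ≤ d k) → sumSym n c ≤ sumSym n d
sumSym-mono zero c≤d = c≤d _
sumSym-mono (suc n) c≤d = +-mono-≤ (+-mono-≤ (sumSym-mono n c≤d) (c≤d _)) (c≤d _)

sumSym-+ : ∀ n (c d : ℤ → ℕ) → sumSym n (λ k → c k + d k) ≡ sumSym n c + sumSym n d
sumSym-+ zero c d = refl
sumSym-+ (suc n) c d = begin
  sumSym n (λ k → c k + d k) + (c p + d p) + (c q + d q)
    ≡⟨ cong (λ s → s + (c p + d p) + (c q + d q)) (sumSym-+ n c d) ⟩
  sumSym n c + sumSym n d + (c p + d p) + (c q + d q)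
    ≡⟨ interchange (sumSym n c) (sumSym n d) (c p) (d p) (c q) (d q) ⟩
  sumSym n c + c p + c q + (sumSym n d + d p + d q)
    ∎
  where
  open ≡-Reasoning
  p = + suc n
  q = -[1+ n ]
  interchange : ∀ a b c d e f → a + b + (c + d) + (e + f) ≡ a + c + e + (b + d + f)
  interchange = solve-∀

sumSym-IsSum : ∀ n f g h → IsSum f g h → sumSym n (coeff f) ≡ sumSym n (coeff g) + sumSym n (coeff h)
sumSym-IsSum n f g h f≡g+h = trans (sumSym-cong n f≡g+h) (sumSym-+ n (coeff g) (coeff h))

minus : Laurent → Laurent → Laurent
minus f g = record
  { coeff = λ k → coeff f k ∸ coeff g k
  ; bound = bound f
  ; vanish = λ k B<∣k∣ → subst (λ c → c ∸ coeff g k ≡ 0) (sym (vanish f k B<∣k∣)) (0∸n≡0 (coeff g k))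
  }

IsSum-restrict-minus : ∀ f L → IsSum f (restrict f L) (minus f (restrict f L))
IsSum-restrict-minus f L k = sym (m+[n∸m]≡n (restrict-≤ f L k))

eval1-≤-restrict-++ : ∀ f A B → (∀ {k} → InSupp f k → k ∈ A ++ B) →
  eval1 f ≤ eval1 (restrict f A) + eval1 (restrict f B)
eval1-≤-restrict-++ f A B supp⊆ =
  subst (eval1 f ≤_) (sumSym-+ (bound f) (coeff (restrict f A)) (coeff (restrict f B)))
    (sumSym-mono (bound f) pointwise)
  where
  both : ℤ → ℕ
  both k = coeff (restrict f A) k + coeff (restrict f B) k
  pointwise : ∀ k → coeff f k ≤ both k
  pointwise k with coeff f k ≟ 0
  ... | yes fk≡0 = subst (_≤ both k) (sym fk≡0) z≤n
  ... | no fk≢0 with ∈-++⁻ A (supp⊆ fk≢0)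
  ...   | inj₁ k∈A = subst (_≤ both k) (restrict-∈ f A k∈A) (m≤m+n _ _)
  ...   | inj₂ k∈B = subst (_≤ both k) (restrict-∈ f B k∈B) (m≤n+m _ _)

Halving : Laurent → Set
Halving f = ∃[ g ] ∃[ h ] (IsSum f g h × HyperMonolithic g × eval1 h ≤ eval1 g)

halve-by-heavier : ∀ f A B → eval1 f ≤ eval1 (restrict f A) + eval1 (restrict f B) →
  eval1 (restrict f B) ≤ eval1 (restrict f A) → HyperMonolithic (restrict f A) → Halving f
halve-by-heavier f A B f≤A+B B≤A hmA =
  gA , minus f gA , IsSum-restrict-minus f A , hmA ,
  ≤-trans (+-cancelˡ-≤ (eval1 gA) (eval1 (minus f gA)) (eval1 (restrict f B)) A+rest≤A+B) B≤A
  where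
  gA : Laurent
  gA = restrict f A
  A+rest≤A+B : eval1 gA + eval1 (minus f gA) ≤ eval1 gA + eval1 (restrict f B)
  A+rest≤A+B = subst (_≤ eval1 gA + eval1 (restrict f B))
    (sumSym-IsSum (bound f) f gA (minus f gA) (IsSum-restrict-minus f A)) f≤A+B

halve-by-restriction : ∀ f A B → (∀ {k} → InSupp f k → k ∈ A ++ B) →
  HyperMonolithic (restrict f A) → HyperMonolithic (restrict f B) → Halving f
halve-by-restriction f A B supp⊆ hmA hmB with ≤-total (eval1 (restrict f B)) (eval1 (restrict f A))
... | inj₁ B≤A = halve-by-heavier f A B (eval1-≤-restrict-++ f A B supp⊆) B≤A hmA
... | inj₂ A≤B = halve-by-heavier f B A
  (subst (eval1 f ≤_) (+-comm (eval1 (restrict f A)) _) (eval1-≤-restrict-++ f A B supp⊆)) A≤B hmB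

halve-by-enumeration : ∀ f x y r → Decreasing (x ∷ y ∷ r) →
  (∀ {k} → k ∈ x ∷ y ∷ r → InSupp f k) → (∀ {k} → InSupp f k → k ∈ x ∷ y ∷ r) → Halving f
halve-by-enumeration f x y r decreasing sound complete with minGapCover x y r decreasing
... | δ , δ>0 , _ , cover A B tightA tightB A⊆P B⊆P P⊆A++B =
  halve-by-restriction f A B (P⊆A++B ∘ complete)
    (TightFirst⇒hyperMonolithic δ>0 tightA (sound ∘ A⊆P))
    (TightLast⇒hyperMonolithic δ>0 tightB (sound ∘ B⊆P))

-- Two distinct support points already suffice.
lemma2p9 : (f : Laurent) → SuppAtLeast3 f →
    ∃[ g ] ∃[ h ] (IsSum f g h × HyperMonolithic g × eval1 h ≤ eval1 g)
lemma2p9 f (a , b , _ , a≢b , _ , _ , a∈supp , b∈supp , _)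
  with support f | support-decreasing f | ∈-support⁻ f | ∈-support⁺ f
... | x ∷ y ∷ r | decreasing | sound | complete = halve-by-enumeration f x y r decreasing sound complete
... | x ∷ [] | _ | _ | complete =
  contradiction (trans (singleton⁻ (complete a∈supp)) (sym (singleton⁻ (complete b∈supp)))) a≢b
... | [] | _ | _ | complete with complete a∈supp
...   | ()
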